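{- Let $r\geq 2$ and $\ell\geq 3$ be integers. Let $H$ be a linear hypergraph whose edges have sizes between $2$ and $r$, and suppose $H$ contains no linear cycle of length $\ell$. Let $D=\partial_2(H)$. Then for every vertex $v\in V(H)$, $|D[N_H(v)]|\leq r^{r+4}\ell\,|N_H(v)|$.
   Context: A hypergraph is linear if any two distinct edges share at most one vertex. A linear cycle of length $\ell$ is a list of sets $A_1,\ldots,A_\ell$ with $|A_i\cap A_{i+1}|=1$ for $i\in[\ell-1]$, $|A_\ell\cap A_1|=1$, and $A_i\cap A_j=\emptyset$ for other pairs $i\neq j$. $\partial_2(H)$ is the graph of all pairs of vertices contained in some edge of $H$. $N_H(v)$ is the set of vertices $u$ such that some edge of $H$ contains $\{u,v\}$. $D[U]$ is the subgraph of $D$ induced by $U$ and $|D[U]|$ its number of edges. -}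

module Defs where

open import Data.Nat using (ℕ; zero; suc; _+_; _≤_)
open import Data.Bool using (Bool; true; false; _∧_; _∨_; not)
open import Data.Fin using (Fin; toℕ; _<?_)
open import Data.Fin.Properties using (_≟_)
open import Data.Fin.Subset using (Subset; _∩_; ∣_∣; Empty)
open import Data.Vec using (lookup; tabulate)
open import Data.Product using (_×_; Σ)
open import Data.Sum using (_⊎_)
open import Relation.Binary.PropositionalEquality using (_≡_; _≢_)
open import Relation.Nullary.Decidable using (⌊_⌋)

Hypergraph : ℕ → ℕ → Set
Hypergraph n m = Fin m → Subset n

IsLinear : ∀ {n m} → Hypergraph n m → Set
IsLinear {m = m} E = (i j : Fin m) → i ≢ j → ∣ E i ∩ E j ∣ ≤ 1

EdgeSizesBetween2And : ∀ {n m} → ℕ → Hypergraph n m → Set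
EdgeSizesBetween2And {m = m} r E = (i : Fin m) → 2 ≤ ∣ E i ∣ × ∣ E i ∣ ≤ r

CycAdj : ∀ {ℓ} → Fin ℓ → Fin ℓ → Set
CycAdj {ℓ} i j =
  (suc (toℕ i) ≡ toℕ j) ⊎ (suc (toℕ j) ≡ toℕ i)
  ⊎ ((toℕ i ≡ 0) × (suc (toℕ j) ≡ ℓ)) ⊎ ((toℕ j ≡ 0) × (suc (toℕ i) ≡ ℓ))

IsLinearCycle : ∀ {n m} → Hypergraph n m → (ℓ : ℕ) → (Fin ℓ → Fin m) → Set
IsLinearCycle E ℓ c =
  ((i j : Fin ℓ) → CycAdj i j → ∣ E (c i) ∩ E (c j) ∣ ≡ 1)
  × ((i j : Fin ℓ) → i ≢ j → (CycAdj i j → Data.Empty.⊥) → Empty (E (c i) ∩ E (c j)))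
  where import Data.Empty

ContainsLinearCycle : ∀ {n m} → Hypergraph n m → ℕ → Set
ContainsLinearCycle {m = m} E ℓ = Σ (Fin ℓ → Fin m) (IsLinearCycle E ℓ)

anyFin : ∀ {m} → (Fin m → Bool) → Bool
anyFin {zero} p = false
anyFin {suc m} p = p Fin.zero ∨ anyFin (λ i → p (Fin.suc i))
  where import Data.Fin as Fin

CoEdge : ∀ {n m} → Hypergraph n m → Fin n → Fin n → Bool
CoEdge E x y = anyFin (λ i → lookup (E i) x ∧ lookup (E i) y)

shadowAdj : ∀ {n m} → Hypergraph n m → Fin n → Fin n → Bool
shadowAdj E x y = not ⌊ x ≟ y ⌋ ∧ CoEdge E x y

nbhd : ∀ {n m} → Hypergraph n m → Fin n → Subset n
nbhd E v = tabulate (λ u → not ⌊ u ≟ v ⌋ ∧ CoEdge E u v)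

countFin : ∀ {n} → (Fin n → Bool) → ℕ
countFin {zero} p = zero
countFin {suc n} p = (if p Fin.zero then 1 else 0) + countFin (λ i → p (Fin.suc i))
  where import Data.Fin as Fin
        open import Data.Bool using (if_then_else_)

sumFin : ∀ {n} → (Fin n → ℕ) → ℕ
sumFin {zero} f = zero
sumFin {suc n} f = f Fin.zero + sumFin (λ i → f (Fin.suc i))
  where import Data.Fin as Fin

inducedEdgeCount : ∀ {n} → (Fin n → Fin n → Bool) → Subset n → ℕ
inducedEdgeCount D U =
  sumFin (λ x → countFin (λ y →
    ⌊ x <? y ⌋ ∧ lookup U x ∧ lookup U y ∧ D x y))

module Submission where

-- Put K = r + 2ℓr². Every nonempty set U of neighbours of v contains a vertex of degree at
-- most K in D[U]; otherwise grow a linear path e₀ ∋ v, e₁, …, e_k greedily: from its end x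
-- step along an edge f through x and a D[U]-neighbour y of x, choosing y outside the at
-- most K vertices that are collinear with x and v, with v and a vertex of e₁ … e_k, or with
-- x and a vertex of e₀ … e_{k−1}. The edge through y and v then closes the path into a
-- linear cycle of length k + 2, which for k = ℓ − 2 is forbidden. So D[N(v)] is
-- K-degenerate, has at most 2K|N(v)| edges, and 2K ≤ r^(r+4) ℓ.

open import Defs
open import Data.Bool using (Bool; true; false; T; not; _∧_; _∨_; if_then_else_)
open import Data.Bool.Properties using (T-∧; T-∨; ∧-comm)
open import Data.Empty using (⊥-elim)
open import Data.Fin using (Fin; zero; suc; toℕ; fromℕ<; _<?_)
open import Data.Fin.Properties using (_≟_; any?; 0≢1+n; toℕ<n; toℕ-injective; toℕ-fromℕ<) renaming (suc-injective to Fin-suc-injective)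
open import Data.Fin.Subset using (Subset; ∣_∣; _∩_; Empty; _∈_)
open import Data.Fin.Subset.Properties using (x∈p∩q⁻)
open import Data.Nat using (ℕ; zero; suc; _+_; _*_; _^_; _≤_; _<_; z≤n; s≤s; s≤s⁻¹; _≤?_)
open import Data.Nat.Properties hiding (_≟_; _<?_; 0≢1+n)
open import Data.Nat.Properties using () renaming (_≟_ to _≟ℕ_)
open import Data.Nat.Tactic.RingSolver using (solve-∀)
open import Data.Product using (_×_; _,_; proj₁; proj₂; ∃)
open import Data.Sum using (inj₁; inj₂)
open import Data.Unit using (tt)
open import Data.Vec using ([]; _∷_; lookup; tabulate)
open import Data.Vec.Properties using (lookup-zipWith; []=⇒lookup; lookup∘tabulate)
open import Function using (_∘_; id; _$_)
open import Function.Bundles using (Equivalence)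
open import Relation.Binary.PropositionalEquality
open import Relation.Binary.Definitions using (tri<; tri≈; tri>)
open import Relation.Nullary using (¬_; yes; no)
open import Relation.Nullary.Decidable using (⌊_⌋; toWitness; fromWitness; T?; _×-dec_)

open Equivalence using (to; from)
open import Algebra.Properties.CommutativeSemigroup +-commutativeSemigroup using () renaming (interchange to +-interchange)

private
  variable
    k n m : ℕ

-- Counting over Fin

T-not⇒¬T : ∀ {b} → T (not b) → ¬ T b
T-not⇒¬T {false} _ ()

anyFin-intro : (p : Fin k → Bool) (i : Fin k) → T (p i) → T (anyFin p)
anyFin-intro p zero    pi = from T-∨ (inj₁ pi)
anyFin-intro p (suc i) pi = from T-∨ (inj₂ (anyFin-intro (p ∘ suc) i pi))

anyFin-elim : (p : Fin k → Bool) → T (anyFin p) → ∃ λ i → T (p i)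
anyFin-elim {suc k} p t with to T-∨ t
... | inj₁ p0 = zero , p0
... | inj₂ ps with anyFin-elim (p ∘ suc) ps
...   | i , pi = suc i , pi

anyFin-cong : (p q : Fin k → Bool) → (∀ i → p i ≡ q i) → anyFin p ≡ anyFin q
anyFin-cong {zero}  p q eq = refl
anyFin-cong {suc k} p q eq = cong₂ _∨_ (eq zero) (anyFin-cong (p ∘ suc) (q ∘ suc) (eq ∘ suc))

card≡countFin : (U : Subset n) → ∣ U ∣ ≡ countFin (lookup U)
card≡countFin []          = refl
card≡countFin (true ∷ U)  = cong suc (card≡countFin U)
card≡countFin (false ∷ U) = card≡countFin U

countFin-const-true : countFin {n} (λ _ → true) ≡ n
countFin-const-true {zero}  = refl
countFin-const-true {suc n} = cong suc countFin-const-true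

countFin-≡0 : (p : Fin n → Bool) → (∀ i → ¬ T (p i)) → countFin p ≡ 0
countFin-≡0 {zero}  p ¬p = refl
countFin-≡0 {suc n} p ¬p with p zero in eq
... | true  = ⊥-elim (¬p zero (subst T (sym eq) tt))
... | false = countFin-≡0 (p ∘ suc) (¬p ∘ suc)

countFin-≥1 : (p : Fin n → Bool) (i : Fin n) → T (p i) → 1 ≤ countFin p
countFin-≥1 {suc n} p i pi with p zero in eq
... | true = s≤s z≤n
countFin-≥1 p zero    pi | false = ⊥-elim (subst T eq pi)
countFin-≥1 p (suc i) pi | false = countFin-≥1 (p ∘ suc) i pi

countFin-≥2 : (p : Fin n → Bool) (i j : Fin n) → i ≢ j → T (p i) → T (p j) → 2 ≤ countFin p
countFin-≥2 p zero    zero    i≢j _  _  = ⊥-elim (i≢j refl)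
countFin-≥2 {suc n} p zero    (suc j) _   pi pj with p zero
... | true = s≤s (countFin-≥1 (p ∘ suc) j pj)
countFin-≥2 {suc n} p (suc i) zero    _   pi pj with p zero
... | true = s≤s (countFin-≥1 (p ∘ suc) i pi)
countFin-≥2 {suc n} p (suc i) (suc j) i≢j pi pj with p zero
... | true  = s≤s (countFin-≥1 (p ∘ suc) i pi)
... | false = countFin-≥2 (p ∘ suc) i j (i≢j ∘ cong suc) pi pj

countFin-≤1 : (p : Fin n → Bool) → (∀ i j → T (p i) → T (p j) → i ≡ j) → countFin p ≤ 1
countFin-≤1 {zero}  p unique = z≤n
countFin-≤1 {suc n} p unique with p zero in eq
... | true  = ≤-reflexive (cong suc (countFin-≡0 (p ∘ suc) λ j pj →
                0≢1+n (unique zero (suc j) (subst T (sym eq) tt) pj)))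
... | false = countFin-≤1 (p ∘ suc) (λ i j pi pj → Fin-suc-injective (unique (suc i) (suc j) pi pj))

infix 4 _⊆ᵇ_
_⊆ᵇ_ : (Fin n → Bool) → (Fin n → Bool) → Set
p ⊆ᵇ q = ∀ i → T (p i) → T (q i)

countFin-mono : (p q : Fin n → Bool) → p ⊆ᵇ q → countFin p ≤ countFin q
countFin-mono {zero}  p q p⊆q = z≤n
countFin-mono {suc n} p q p⊆q with p zero in eqp | q zero in eqq
... | false | false = countFin-mono (p ∘ suc) (q ∘ suc) (p⊆q ∘ suc)
... | false | true  = m≤n⇒m≤1+n (countFin-mono (p ∘ suc) (q ∘ suc) (p⊆q ∘ suc))
... | true  | true  = s≤s (countFin-mono (p ∘ suc) (q ∘ suc) (p⊆q ∘ suc))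
... | true  | false = ⊥-elim (subst T eqq (p⊆q zero (subst T (sym eqp) tt)))

countFin-∨ : (p q : Fin n → Bool) → countFin (λ i → p i ∨ q i) ≤ countFin p + countFin q
countFin-∨ {zero}  p q = z≤n
countFin-∨ {suc n} p q with p zero | q zero | countFin-∨ (p ∘ suc) (q ∘ suc)
... | false | false | ih = ih
... | false | true  | ih = ≤-trans (s≤s ih) (≤-reflexive (sym (+-suc _ _)))
... | true  | false | ih = s≤s ih
... | true  | true  | ih = s≤s (≤-trans ih (+-monoʳ-≤ (countFin (p ∘ suc)) (n≤1+n _)))

countFin-partition : (p q : Fin n → Bool) →
  countFin p ≡ countFin (λ i → p i ∧ not (q i)) + countFin (λ i → p i ∧ q i)
countFin-partition {zero}  p q = refl
countFin-partition {suc n} p q with p zero | q zero | countFin-partition (p ∘ suc) (q ∘ suc)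
... | false | _     | ih = ih
... | true  | false | ih = cong suc ih
... | true  | true  | ih = trans (cong suc ih) (sym (+-suc _ _))

countFin-<⇒∃ : (p q : Fin n → Bool) → countFin q < countFin p → ∃ λ i → T (p i) × ¬ T (q i)
countFin-<⇒∃ p q q<p with anyFin (λ i → p i ∧ not (q i)) in eq
... | true with anyFin-elim (λ i → p i ∧ not (q i)) (subst T (sym eq) tt)
...   | i , pi∧¬qi = i , proj₁ (to T-∧ pi∧¬qi) , T-not⇒¬T (proj₂ (to T-∧ pi∧¬qi))
countFin-<⇒∃ p q q<p | false = ⊥-elim (<⇒≱ q<p (begin
    countFin p                                                    ≡⟨ countFin-partition p q ⟩
    countFin (λ i → p i ∧ not (q i)) + countFin (λ i → p i ∧ q i) ≡⟨ cong (_+ countFin (λ i → p i ∧ q i)) none ⟩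
    countFin (λ i → p i ∧ q i)                                    ≤⟨ countFin-mono _ q (λ i → proj₂ ∘ to T-∧) ⟩
    countFin q                                                    ∎))
  where
  open ≤-Reasoning
  none : countFin (λ i → p i ∧ not (q i)) ≡ 0
  none = countFin-≡0 _ λ i t → subst T eq (anyFin-intro (λ i → p i ∧ not (q i)) i t)

countFin-⊆-singleton : (p : Fin n → Bool) (x : Fin n) → p ⊆ᵇ (λ a → ⌊ a ≟ x ⌋) → countFin p ≤ 1
countFin-⊆-singleton p x p⊆x = countFin-≤1 p λ i j pi pj →
  trans (toWitness (p⊆x i pi)) (sym (toWitness (p⊆x j pj)))

remove : (Fin n → Bool) → Fin n → Fin n → Bool
remove u x y = u y ∧ not ⌊ y ≟ x ⌋

countFin-remove : (u : Fin n → Bool) (x : Fin n) → T (u x) → suc (countFin (remove u x)) ≤ countFin u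
countFin-remove u x ux = begin
  suc (countFin (remove u x))                                  ≡⟨ +-comm 1 _ ⟩
  countFin (remove u x) + 1                                    ≤⟨ +-monoʳ-≤ (countFin (remove u x)) x∈u∩x ⟩
  countFin (remove u x) + countFin (λ y → u y ∧ ⌊ y ≟ x ⌋)    ≡⟨ countFin-partition u (λ y → ⌊ y ≟ x ⌋) ⟨
  countFin u                                                   ∎
  where
  open ≤-Reasoning
  x∈u∩x : 1 ≤ countFin (λ y → u y ∧ ⌊ y ≟ x ⌋)
  x∈u∩x = countFin-≥1 _ x (from T-∧ (ux , fromWitness refl))

sumFin-≡0 : (f : Fin n → ℕ) → (∀ i → f i ≡ 0) → sumFin f ≡ 0
sumFin-≡0 {zero}  f f≡0 = refl
sumFin-≡0 {suc n} f f≡0 rewrite f≡0 zero = sumFin-≡0 (f ∘ suc) (f≡0 ∘ suc)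

sumFin-mono : (f g : Fin n → ℕ) → (∀ i → f i ≤ g i) → sumFin f ≤ sumFin g
sumFin-mono {zero}  f g f≤g = z≤n
sumFin-mono {suc n} f g f≤g = +-mono-≤ (f≤g zero) (sumFin-mono (f ∘ suc) (g ∘ suc) (f≤g ∘ suc))

sumFin-+ : (f g : Fin n → ℕ) → sumFin (λ i → f i + g i) ≡ sumFin f + sumFin g
sumFin-+ {zero}  f g = refl
sumFin-+ {suc n} f g = trans (cong (f zero + g zero +_) (sumFin-+ (f ∘ suc) (g ∘ suc)))
                              (+-interchange (f zero) (g zero) (sumFin (f ∘ suc)) (sumFin (g ∘ suc)))

sumFin-≤-countFin-* : (f : Fin n → ℕ) (s : Fin n → Bool) (c : ℕ) →
  (∀ i → f i ≤ (if s i then c else 0)) → sumFin f ≤ countFin s * c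
sumFin-≤-countFin-* {zero}  f s c f≤ = z≤n
sumFin-≤-countFin-* {suc n} f s c f≤ with s zero | f≤ zero
... | true  | f0≤c = +-mono-≤ f0≤c (sumFin-≤-countFin-* (f ∘ suc) (s ∘ suc) c (f≤ ∘ suc))
... | false | f0≤0 = +-mono-≤ f0≤0 (sumFin-≤-countFin-* (f ∘ suc) (s ∘ suc) c (f≤ ∘ suc))

countFin-anyFin-≤ : (s : Fin k → Bool) (P : Fin k → Fin n → Bool) (c : ℕ) →
  (∀ i → T (s i) → countFin (P i) ≤ c) →
  countFin (λ y → anyFin (λ i → s i ∧ P i y)) ≤ countFin s * c
countFin-anyFin-≤ {zero} {n} s P c P≤c = ≤-reflexive (countFin-≡0 {n} (λ _ → false) λ _ ())
countFin-anyFin-≤ {suc k} s P c P≤c with s zero in eq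
... | true  = ≤-trans (countFin-∨ (P zero) _)
                (+-mono-≤ (P≤c zero (subst T (sym eq) tt)) (countFin-anyFin-≤ (s ∘ suc) (P ∘ suc) c (P≤c ∘ suc)))
... | false = countFin-anyFin-≤ (s ∘ suc) (P ∘ suc) c (P≤c ∘ suc)

-- Degenerate graphs

module Degeneracy (D : Fin n → Fin n → Bool) (D-sym : ∀ a b → D a b ≡ D b a) where

  -- edgesIn (lookup U) is definitionally inducedEdgeCount D U.
  edgesIn : (Fin n → Bool) → ℕ
  edgesIn u = sumFin (λ a → countFin (λ b → ⌊ a <? b ⌋ ∧ u a ∧ u b ∧ D a b))

  degreeIn : (Fin n → Bool) → Fin n → ℕ
  degreeIn u x = countFin (λ y → u y ∧ D x y)

  edgesIn-empty : (u : Fin n → Bool) → (∀ a → ¬ T (u a)) → edgesIn u ≡ 0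
  edgesIn-empty u ∅ = sumFin-≡0 _ λ a → countFin-≡0 (λ b → ⌊ a <? b ⌋ ∧ u a ∧ u b ∧ D a b) λ b t →
    ∅ a (proj₁ (to T-∧ (proj₂ (to (T-∧ {⌊ a <? b ⌋}) t))))

  edgesIn-remove : (u : Fin n → Bool) (x : Fin n) →
    edgesIn u ≤ edgesIn (remove u x) + (degreeIn u x + degreeIn u x)
  edgesIn-remove u x = begin
    edgesIn u
      ≤⟨ sumFin-mono _ _ (λ a → countFin-mono _ _ (row-split a)) ⟩
    sumFin (λ a → countFin (λ b → remaining a b ∨ (atX a b ∨ toX a b)))
      ≤⟨ sumFin-mono _ _ (λ a → ≤-trans (countFin-∨ (remaining a) _) (+-monoʳ-≤ _ (countFin-∨ (atX a) (toX a)))) ⟩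
    sumFin (λ a → countFin (remaining a) + (countFin (atX a) + countFin (toX a)))
      ≡⟨ trans (sumFin-+ (countFin ∘ remaining) (λ a → countFin (atX a) + countFin (toX a)))
               (cong (edgesIn (remove u x) +_) (sumFin-+ (countFin ∘ atX) (countFin ∘ toX))) ⟩
    edgesIn (remove u x) + (sumFin (λ a → countFin (atX a)) + sumFin (λ a → countFin (toX a)))
      ≤⟨ +-monoʳ-≤ (edgesIn (remove u x)) (+-mono-≤ pairs-at-x pairs-to-x) ⟩
    edgesIn (remove u x) + (degreeIn u x + degreeIn u x)
      ∎
    where
    open ≤-Reasoning
    remaining atX toX : Fin n → Fin n → Bool
    remaining a b = ⌊ a <? b ⌋ ∧ remove u x a ∧ remove u x b ∧ D a b
    atX a b = ⌊ a ≟ x ⌋ ∧ (u b ∧ D a b)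
    toX a b = ⌊ b ≟ x ⌋ ∧ (u a ∧ D a b)

    row-split : ∀ a → (λ b → ⌊ a <? b ⌋ ∧ u a ∧ u b ∧ D a b) ⊆ᵇ (λ b → remaining a b ∨ (atX a b ∨ toX a b))
    row-split a b = split ⌊ a <? b ⌋ (u a) (u b) (D a b) ⌊ a ≟ x ⌋ ⌊ b ≟ x ⌋
      where
      split : ∀ a<b ua ub dab a≡x b≡x → T (a<b ∧ ua ∧ ub ∧ dab) →
        T ((a<b ∧ (ua ∧ not a≡x) ∧ (ub ∧ not b≡x) ∧ dab) ∨ ((a≡x ∧ (ub ∧ dab)) ∨ (b≡x ∧ (ua ∧ dab))))
      split true true true true true  _     _ = tt
      split true true true true false true  _ = tt
      split true true true true false false _ = tt

    pairs-at-x : sumFin (λ a → countFin (atX a)) ≤ degreeIn u x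
    pairs-at-x = begin
      sumFin (λ a → countFin (atX a))       ≤⟨ sumFin-≤-countFin-* _ (λ a → ⌊ a ≟ x ⌋) (degreeIn u x) row-at-x ⟩
      countFin (λ a → ⌊ a ≟ x ⌋) * degreeIn u x ≤⟨ *-monoˡ-≤ (degreeIn u x) (countFin-⊆-singleton _ x λ _ → id) ⟩
      1 * degreeIn u x                     ≡⟨ *-identityˡ _ ⟩
      degreeIn u x                         ∎
      where
      row-at-x : ∀ a → countFin (atX a) ≤ (if ⌊ a ≟ x ⌋ then degreeIn u x else 0)
      row-at-x a with a ≟ x
      ... | yes refl = ≤-refl
      ... | no _     = ≤-reflexive (countFin-≡0 {n} (λ _ → false) λ _ ())

    pairs-to-x : sumFin (λ a → countFin (toX a)) ≤ degreeIn u x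
    pairs-to-x = ≤-trans (sumFin-≤-countFin-* _ (λ a → u a ∧ D x a) 1 row-to-x) (≤-reflexive (*-identityʳ _))
      where
      row-to-x : ∀ a → countFin (toX a) ≤ (if u a ∧ D x a then 1 else 0)
      row-to-x a with u a ∧ D x a in eq
      ... | true  = countFin-⊆-singleton (toX a) x λ _ → proj₁ ∘ to T-∧
      ... | false = ≤-reflexive (countFin-≡0 _ not-to-x)
        where
        not-to-x : ∀ b → ¬ T (toX a b)
        not-to-x b t with to T-∧ t
        ... | b≡x , ua∧Dab with toWitness {a? = b ≟ x} b≡x
        ...   | refl = subst T eq (subst (λ d → T (u a ∧ d)) (D-sym a x) ua∧Dab)

  edgesIn-≤-degenerate : (K : ℕ) (u₀ : Fin n → Bool) →
    (∀ u → u ⊆ᵇ u₀ → ∀ x → T (u x) → ∃ λ y → T (u y) × degreeIn u y ≤ K) →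
    edgesIn u₀ ≤ (K + K) * countFin u₀
  edgesIn-≤-degenerate K u₀ low-degree = go (countFin u₀) u₀ (λ _ → id) ≤-refl
    where
    go : ∀ s u → u ⊆ᵇ u₀ → countFin u ≤ s → edgesIn u ≤ (K + K) * countFin u
    go s u u⊆u₀ ∣u∣≤s with any? (T? ∘ u)
    ... | no ∄x = ≤-trans (≤-reflexive (edgesIn-empty u λ a ua → ∄x (a , ua))) z≤n
    ... | yes (x , ux) with low-degree u u⊆u₀ x ux
    ...   | y , uy , deg≤K with s
    ...     | zero   = ⊥-elim (<⇒≱ (countFin-≥1 u y uy) ∣u∣≤s)
    ...     | suc s′ = begin
      edgesIn u                                              ≤⟨ edgesIn-remove u y ⟩
      edgesIn (remove u y) + (degreeIn u y + degreeIn u y)   ≤⟨ +-mono-≤ ih (+-mono-≤ deg≤K deg≤K) ⟩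
      (K + K) * countFin (remove u y) + (K + K)              ≡⟨ +-comm _ (K + K) ⟩
      (K + K) + (K + K) * countFin (remove u y)              ≡⟨ *-suc (K + K) _ ⟨
      (K + K) * suc (countFin (remove u y))                  ≤⟨ *-monoʳ-≤ (K + K) (countFin-remove u y uy) ⟩
      (K + K) * countFin u                                   ∎
      where
      open ≤-Reasoning
      ih : edgesIn (remove u y) ≤ (K + K) * countFin (remove u y)
      ih = go s′ (remove u y) (λ a t → u⊆u₀ a (proj₁ (to T-∧ t)))
             (≤-pred (≤-trans (countFin-remove u y uy) ∣u∣≤s))

-- Linear hypergraphs

≟-sym : (a b : Fin n) → ⌊ a ≟ b ⌋ ≡ ⌊ b ≟ a ⌋
≟-sym a b with a ≟ b | b ≟ a
... | yes _   | yes _   = refl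
... | no  _   | no  _   = refl
... | yes a≡b | no  b≢a = ⊥-elim (b≢a (sym a≡b))
... | no  a≢b | yes b≡a = ⊥-elim (a≢b (sym b≡a))

shadowAdj-sym : (H : Hypergraph n m) (a b : Fin n) → shadowAdj H a b ≡ shadowAdj H b a
shadowAdj-sym H a b = cong₂ (λ a≡b co → not a≡b ∧ co) (≟-sym a b)
  (anyFin-cong _ _ λ e → ∧-comm (lookup (H e) a) (lookup (H e) b))

module LinearHypergraph (H : Hypergraph n m) (linear : IsLinear H) (r : ℕ) (∣H∣≤r : ∀ e → ∣ H e ∣ ≤ r) where

  mem : Fin m → Fin n → Bool
  mem e x = lookup (H e) x

  lookup-∩ : ∀ e f x → lookup (H e ∩ H f) x ≡ (mem e x ∧ mem f x)
  lookup-∩ e f x = lookup-zipWith _∧_ x (H e) (H f)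

  countFin-mem-≤ : ∀ e → countFin (mem e) ≤ r
  countFin-mem-≤ e = subst (_≤ r) (card≡countFin (H e)) (∣H∣≤r e)

  ∩-intro : ∀ {e f z} → T (mem e z) → T (mem f z) → T (lookup (H e ∩ H f) z)
  ∩-intro {e} {f} {z} ez fz = subst T (sym (lookup-∩ e f z)) (from T-∧ (ez , fz))

  ∣∩∣-≥2 : ∀ {e f x y} → x ≢ y → T (mem e x) → T (mem f x) → T (mem e y) → T (mem f y) →
    2 ≤ ∣ H e ∩ H f ∣
  ∣∩∣-≥2 {e} {f} {x} {y} x≢y ex fx ey fy = subst (2 ≤_) (sym (card≡countFin (H e ∩ H f)))
    (countFin-≥2 _ x y x≢y (∩-intro ex fx) (∩-intro ey fy))

  linear-≡ : ∀ {e f x y} → x ≢ y → T (mem e x) → T (mem f x) → T (mem e y) → T (mem f y) → e ≡ f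
  linear-≡ {e} {f} x≢y ex fx ey fy with e ≟ f
  ... | yes e≡f = e≡f
  ... | no  e≢f = ⊥-elim (<⇒≱ (∣∩∣-≥2 x≢y ex fx ey fy) (linear e f e≢f))

  coEdge-elim : ∀ {x y} → T (CoEdge H x y) → ∃ λ e → T (mem e x) × T (mem e y)
  coEdge-elim {x} {y} t with anyFin-elim (λ e → mem e x ∧ mem e y) t
  ... | e , exy = e , to (T-∧ {mem e x}) exy

  shadowAdj-elim : ∀ {x y} → T (shadowAdj H x y) → x ≢ y × ∃ λ e → T (mem e x) × T (mem e y)
  shadowAdj-elim {x} {y} t with to (T-∧ {not ⌊ x ≟ y ⌋}) t
  ... | x≢y , co = (λ x≡y → T-not⇒¬T x≢y (fromWitness x≡y)) , coEdge-elim co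

  nbhd-elim : ∀ {v y} → T (lookup (nbhd H v) y) → y ≢ v × ∃ λ e → T (mem e y) × T (mem e v)
  nbhd-elim {v} {y} t = shadowAdj-elim (subst T (lookup∘tabulate (λ z → shadowAdj H z v) y) t)

  Meet : Fin m → Fin m → Set
  Meet e f = e ≢ f × ∃ λ z → T (mem e z) × T (mem f z)

  Meet-sym : ∀ {e f} → Meet e f → Meet f e
  Meet-sym (e≢f , z , ez , fz) = e≢f ∘ sym , z , fz , ez

  Meet⇒∣∩∣≡1 : ∀ {e f} → Meet e f → ∣ H e ∩ H f ∣ ≡ 1
  Meet⇒∣∩∣≡1 {e} {f} (e≢f , z , ez , fz) = ≤-antisym (linear e f e≢f)
    (subst (1 ≤_) (sym (card≡countFin (H e ∩ H f))) (countFin-≥1 _ z (∩-intro ez fz)))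

  Disjoint : Fin m → Fin m → Set
  Disjoint e f = ∀ z → T (mem e z) → ¬ T (mem f z)

  Disjoint-sym : ∀ {e f} → Disjoint e f → Disjoint f e
  Disjoint-sym e∩f=∅ z fz ez = e∩f=∅ z ez fz

  Disjoint⇒Empty : ∀ {e f} → Disjoint e f → Empty (H e ∩ H f)
  Disjoint⇒Empty {e} {f} e∩f=∅ (z , z∈e∩f) with x∈p∩q⁻ (H e) (H f) z∈e∩f
  ... | z∈e , z∈f = e∩f=∅ z (∈⇒T z∈e) (∈⇒T z∈f)
    where
    ∈⇒T : ∀ {p : Subset n} {x} → x ∈ p → T (lookup p x)
    ∈⇒T x∈p = subst T (sym ([]=⇒lookup x∈p)) tt

  collinear : Fin n → Fin n → Fin n → Bool
  collinear a b y = anyFin (λ e → mem e a ∧ mem e b ∧ mem e y)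

  collinear-intro : ∀ {a b y} e → T (mem e a) → T (mem e b) → T (mem e y) → T (collinear a b y)
  collinear-intro {a} {b} {y} e ea eb ey =
    anyFin-intro (λ f → mem f a ∧ mem f b ∧ mem f y) e (from T-∧ (ea , from T-∧ (eb , ey)))

  collinear-elim : ∀ {a b y} → T (collinear a b y) → ∃ λ e → T (mem e a) × T (mem e b) × T (mem e y)
  collinear-elim {a} {b} {y} t with anyFin-elim (λ e → mem e a ∧ mem e b ∧ mem e y) t
  ... | e , eaby with to (T-∧ {mem e a}) eaby
  ...   | ea , eby = e , ea , to (T-∧ {mem e b}) eby

  countFin-collinear-≤ : ∀ {a b} → a ≢ b → countFin (collinear a b) ≤ r
  countFin-collinear-≤ {a} {b} a≢b with any? (λ e → T? (mem e a ∧ mem e b))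
  ... | yes (e , eab) = ≤-trans (countFin-mono _ (mem e) on-e) (countFin-mem-≤ e)
    where
    on-e : collinear a b ⊆ᵇ mem e
    on-e y t with collinear-elim t | to (T-∧ {mem e a}) eab
    ... | f , fa , fb , fy | ea , eb with linear-≡ a≢b fa ea fb eb
    ...   | refl = fy
  ... | no ∄e = ≤-trans (≤-reflexive (countFin-≡0 _ none)) z≤n
    where
    none : ∀ y → ¬ T (collinear a b y)
    none y t with collinear-elim t
    ... | e , ea , eb , _ = ∄e (e , from T-∧ (ea , eb))

  collinearWithSome : Fin n → (Fin n → Bool) → Fin n → Bool
  collinearWithSome a S y = anyFin (λ z → S z ∧ collinear a z y)

  collinearWithSome-intro : ∀ {a S y z} e → T (S z) → T (mem e a) → T (mem e z) → T (mem e y) →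
    T (collinearWithSome a S y)
  collinearWithSome-intro {a} {S} {y} {z} e Sz ea ez ey =
    anyFin-intro (λ z → S z ∧ collinear a z y) z (from T-∧ (Sz , collinear-intro e ea ez ey))

  countFin-collinearWithSome-≤ : ∀ {a} (S : Fin n → Bool) → (∀ z → T (S z) → a ≢ z) →
    countFin (collinearWithSome a S) ≤ countFin S * r
  countFin-collinearWithSome-≤ {a} S a∉S = countFin-anyFin-≤ S (collinear a) r
    (λ z Sz → countFin-collinear-≤ (a∉S z Sz))

  linearCycle : (L : ℕ) (G : ℕ → Fin m) →
    (∀ i → i < L → Meet (G i) (G (suc i))) →
    Meet (G 0) (G L) →
    (∀ i j → suc i < j → j ≤ L → ¬ (i ≡ 0 × j ≡ L) → Disjoint (G i) (G j)) →
    ContainsLinearCycle H (suc L)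
  linearCycle L G consecutive wrap far = G ∘ toℕ , adjacent-meet , nonadjacent-disjoint
    where
    position≤L : (a : Fin (suc L)) → toℕ a ≤ L
    position≤L a = ≤-pred (toℕ<n a)

    adjacent-meet : ∀ a b → CycAdj a b → ∣ H (G (toℕ a)) ∩ H (G (toℕ b)) ∣ ≡ 1
    adjacent-meet a b (inj₁ a+1≡b) = Meet⇒∣∩∣≡1 $
      subst (λ j → Meet (G (toℕ a)) (G j)) a+1≡b (consecutive (toℕ a) (subst (_≤ L) (sym a+1≡b) (position≤L b)))
    adjacent-meet a b (inj₂ (inj₁ b+1≡a)) = Meet⇒∣∩∣≡1 $ Meet-sym $
      subst (λ j → Meet (G (toℕ b)) (G j)) b+1≡a (consecutive (toℕ b) (subst (_≤ L) (sym b+1≡a) (position≤L a)))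
    adjacent-meet a b (inj₂ (inj₂ (inj₁ (a≡0 , b+1≡L+1)))) = Meet⇒∣∩∣≡1 $
      subst₂ (λ i j → Meet (G i) (G j)) (sym a≡0) (sym (suc-injective b+1≡L+1)) wrap
    adjacent-meet a b (inj₂ (inj₂ (inj₂ (b≡0 , a+1≡L+1)))) = Meet⇒∣∩∣≡1 $ Meet-sym $
      subst₂ (λ i j → Meet (G i) (G j)) (sym b≡0) (sym (suc-injective a+1≡L+1)) wrap

    nonadjacent-disjoint : ∀ a b → a ≢ b → ¬ CycAdj a b → Empty (H (G (toℕ a)) ∩ H (G (toℕ b)))
    nonadjacent-disjoint a b a≢b ¬adj with <-cmp (toℕ a) (toℕ b)
    ... | tri≈ _ a≡b _ = ⊥-elim (a≢b (toℕ-injective a≡b))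
    ... | tri< a<b _ _ = Disjoint⇒Empty (far (toℕ a) (toℕ b) a+1<b (position≤L b) not-wrap)
      where
      a+1<b : suc (toℕ a) < toℕ b
      a+1<b = ≤∧≢⇒< a<b (¬adj ∘ inj₁)
      not-wrap : ¬ (toℕ a ≡ 0 × toℕ b ≡ L)
      not-wrap (a≡0 , b≡L) = ¬adj (inj₂ (inj₂ (inj₁ (a≡0 , cong suc b≡L))))
    ... | tri> _ _ b<a = Disjoint⇒Empty (Disjoint-sym (far (toℕ b) (toℕ a) b+1<a (position≤L a) not-wrap))
      where
      b+1<a : suc (toℕ b) < toℕ a
      b+1<a = ≤∧≢⇒< b<a (¬adj ∘ inj₂ ∘ inj₁)
      not-wrap : ¬ (toℕ b ≡ 0 × toℕ a ≡ L)
      not-wrap (b≡0 , a≡L) = ¬adj (inj₂ (inj₂ (inj₂ (b≡0 , cong suc a≡L))))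

  onPrefix : (ℕ → Fin m) → ℕ → Fin n → Bool
  onPrefix es k z = anyFin {k} (λ i → mem (es (toℕ i)) z)

  onPrefix-intro : ∀ (es : ℕ → Fin m) {k i z} → i < k → T (mem (es i) z) → T (onPrefix es k z)
  onPrefix-intro es {k} {i} {z} i<k ez = anyFin-intro (λ j → mem (es (toℕ j)) z) (fromℕ< i<k)
    (subst (λ j → T (mem (es j) z)) (sym (toℕ-fromℕ< i<k)) ez)

  onPrefix-elim : ∀ (es : ℕ → Fin m) {k z} → T (onPrefix es k z) → ∃ λ i → i < k × T (mem (es i) z)
  onPrefix-elim es {k} {z} t with anyFin-elim (λ j → mem (es (toℕ j)) z) t
  ... | i , ez = toℕ i , toℕ<n i , ez

  countFin-onPrefix-≤ : ∀ (es : ℕ → Fin m) k → countFin (onPrefix es k) ≤ k * r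
  countFin-onPrefix-≤ es k = subst (λ c → countFin (onPrefix es k) ≤ c * r) (countFin-const-true {k})
    (countFin-anyFin-≤ {k} (λ _ → true) (mem ∘ es ∘ toℕ) r (λ i _ → countFin-mem-≤ (es (toℕ i))))

-- Greedy linear paths in the link of a vertex

_[_]≔_ : {A : Set} → (ℕ → A) → ℕ → A → ℕ → A
(g [ j ]≔ a) i = if ⌊ i ≟ℕ j ⌋ then a else g i

[]≔-≡ : {A : Set} (g : ℕ → A) (j : ℕ) (a : A) → (g [ j ]≔ a) j ≡ a
[]≔-≡ g j a with j ≟ℕ j
... | yes _   = refl
... | no  j≢j = ⊥-elim (j≢j refl)

[]≔-≢ : {A : Set} (g : ℕ → A) {i j : ℕ} (a : A) → i ≢ j → (g [ j ]≔ a) i ≡ g i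
[]≔-≢ g {i} {j} a i≢j with i ≟ℕ j
... | yes i≡j = ⊥-elim (i≢j i≡j)
... | no  _   = refl

-- The number of vertices a greedy extension step has to avoid.
greedyBound : ℕ → ℕ → ℕ
greedyBound r ℓ = r + (ℓ * r * r + ℓ * r * r)

greedyBound-double-≤ : ∀ r ℓ → 2 ≤ r → 1 ≤ ℓ → greedyBound r ℓ + greedyBound r ℓ ≤ r ^ (r + 4) * ℓ
greedyBound-double-≤ _ zero _ ()
greedyBound-double-≤ 1 (suc _) (s≤s ()) _
greedyBound-double-≤ r@(suc (suc r′)) ℓ@(suc _) 2≤r _ = begin
  (r + (X + X)) + (r + (X + X)) ≤⟨ +-mono-≤ r+2X≤3X r+2X≤3X ⟩
  (X + (X + X)) + (X + (X + X)) ≡⟨ 6X≡6r²ℓ ℓ r ⟩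
  r * (r * 6) * ℓ               ≤⟨ *-monoˡ-≤ ℓ (*-monoʳ-≤ r (*-monoʳ-≤ r 6≤r^4)) ⟩
  r ^ 6 * ℓ                     ≤⟨ *-monoˡ-≤ ℓ (^-monoʳ-≤ r {6} {r + 4} (s≤s (s≤s (m≤n+m 4 r′)))) ⟩
  r ^ (r + 4) * ℓ               ∎
  where
  open ≤-Reasoning
  X = ℓ * r * r
  r+2X≤3X : r + (X + X) ≤ X + (X + X)
  r+2X≤3X = +-monoˡ-≤ (X + X) (≤-trans (m≤n*m r ℓ) (m≤m*n (ℓ * r) r))
  6≤r^4 : 6 ≤ r ^ 4
  6≤r^4 = ≤-trans (s≤s (s≤s (s≤s (s≤s (s≤s (s≤s z≤n)))))) (^-monoˡ-≤ 4 {2} {r} 2≤r)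
  6X≡6r²ℓ : ∀ a b → (a * b * b + (a * b * b + a * b * b)) + (a * b * b + (a * b * b + a * b * b)) ≡ b * (b * 6) * a
  6X≡6r²ℓ = solve-∀

module GreedyPath (H : Hypergraph n m) (linear : IsLinear H) (r : ℕ) (∣H∣≤r : ∀ e → ∣ H e ∣ ≤ r)
                  (v : Fin n) (u : Fin n → Bool) (u⊆N : u ⊆ᵇ lookup (nbhd H v)) where

  open LinearHypergraph H linear r ∣H∣≤r
  open Degeneracy (shadowAdj H) (shadowAdj-sym H) using (degreeIn)

  -- A linear path e₀ … e_k with v ∈ e₀ and end ∈ e_k ∩ u, together with an edge through
  -- v and the end that closes it into a linear cycle of length k + 2.
  record Path (k : ℕ) : Set where
    field
      edge            : ℕ → Fin m
      end             : Fin n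
      edge-0∋v        : T (mem (edge 0) v)
      edge-k∋end      : T (mem (edge k) end)
      consecutive     : ∀ i → i < k → Meet (edge i) (edge (suc i))
      far-disjoint    : ∀ i j → suc i < j → j ≤ k → Disjoint (edge i) (edge j)
      v∉edge          : ∀ i → 1 ≤ i → i ≤ k → ¬ T (mem (edge i) v)
      end∈u           : T (u end)
      end∉edge-0      : 1 ≤ k → ¬ T (mem (edge 0) end)
      closer          : Fin m
      closer∋v        : T (mem closer v)
      closer∋end      : T (mem closer end)
      closer-disjoint : ∀ i → 1 ≤ i → i < k → Disjoint closer (edge i)

  open Path

  mem-subst : ∀ {e e′ z} → e ≡ e′ → T (mem e z) → T (mem e′ z)
  mem-subst {z = z} = subst (λ e → T (mem e z))

  start : ∀ {x} → T (u x) → Path 0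
  start {x} ux with nbhd-elim (u⊆N x ux)
  ... | _ , e , ex , ev = record
    { edge            = λ _ → e
    ; end             = x
    ; edge-0∋v        = ev
    ; edge-k∋end      = ex
    ; consecutive     = λ _ ()
    ; far-disjoint    = λ _ _ i+1<j j≤0 → ⊥-elim (n≮0 (<-≤-trans i+1<j j≤0))
    ; v∉edge          = λ _ 1≤i i≤0 → ⊥-elim (n≮0 (<-≤-trans 1≤i i≤0))
    ; end∈u           = ux
    ; end∉edge-0      = λ ()
    ; closer          = e
    ; closer∋v        = ev
    ; closer∋end      = ex
    ; closer-disjoint = λ _ _ ()
    }

  end∉earlier : (P : Path k) → ∀ i → i < k → ¬ T (mem (edge P i) (end P))
  end∉earlier P zero    0<k   = end∉edge-0 P 0<k
  end∉earlier P (suc i) i+1<k = closer-disjoint P (suc i) (s≤s z≤n) i+1<k (end P) (closer∋end P)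

  last-edge-≢ : (P : Path k) {f : Fin m} → ¬ T (mem f v) → (∀ i → i < k → Disjoint f (edge P i)) →
    edge P k ≢ f
  last-edge-≢ {zero}  P f∌v _ refl = f∌v (edge-0∋v P)
  last-edge-≢ {suc j} P _ f∩earlier=∅ refl with consecutive P j ≤-refl
  ... | _ , z , ejz , fz = f∩earlier=∅ j ≤-refl z fz ejz

  first-edge-∌ : (P : Path k) {f : Fin m} {y : Fin n} → T (mem f (end P)) → T (mem f y) → end P ≢ y →
    ¬ T (mem f v) → (∀ i → i < k → Disjoint f (edge P i)) → ¬ T (mem (edge P 0) y)
  first-edge-∌ {zero} P fx fy x≢y f∌v _ e₀y with linear-≡ x≢y (edge-k∋end P) fx e₀y fy
  ... | refl = f∌v (edge-0∋v P)
  first-edge-∌ {suc j} P _ fy _ _ f∩earlier=∅ e₀y = f∩earlier=∅ 0 (s≤s z≤n) _ fy e₀y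

  forbidden : Path k → Fin n → Bool
  forbidden {k} P y = collinear (end P) v y
    ∨ (collinearWithSome v (onPrefix (edge P ∘ suc) k) y ∨ collinearWithSome (end P) (onPrefix (edge P) k) y)

  countFin-forbidden-≤ : ∀ {ℓ} (P : Path k) → k ≤ ℓ → countFin (forbidden P) ≤ greedyBound r ℓ
  countFin-forbidden-≤ {k} {ℓ} P k≤ℓ =
    ≤-trans (countFin-∨ (collinear (end P) v) _) $
    +-mono-≤ (countFin-collinear-≤ (proj₁ (nbhd-elim (u⊆N (end P) (end∈u P))))) $
    ≤-trans (countFin-∨ (collinearWithSome v (onPrefix (edge P ∘ suc) k)) _) $
    +-mono-≤ (≤-trans (countFin-collinearWithSome-≤ _ v∉later) (prefix-bound (edge P ∘ suc)))
             (≤-trans (countFin-collinearWithSome-≤ _ end∉onPrefix) (prefix-bound (edge P)))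
    where
    prefix-bound : ∀ es → countFin (onPrefix es k) * r ≤ ℓ * r * r
    prefix-bound es = *-monoˡ-≤ r (≤-trans (countFin-onPrefix-≤ es k) (*-monoˡ-≤ r k≤ℓ))
    v∉later : ∀ z → T (onPrefix (edge P ∘ suc) k z) → v ≢ z
    v∉later z t refl with onPrefix-elim (edge P ∘ suc) t
    ... | i , i<k , ev = v∉edge P (suc i) (s≤s z≤n) i<k ev
    end∉onPrefix : ∀ z → T (onPrefix (edge P) k z) → end P ≢ z
    end∉onPrefix z t refl with onPrefix-elim (edge P) t
    ... | i , i<k , ex = end∉earlier P i i<k ex

  module Extension {k : ℕ} (P : Path k) {y : Fin n} {f h : Fin m} (uy : T (u y)) (x≢y : end P ≢ y)
                   (fx : T (mem f (end P))) (fy : T (mem f y)) (hy : T (mem h y)) (hv : T (mem h v))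
                   (allowed : ¬ T (forbidden P y)) where

    ¬collinear : ¬ T (collinear (end P) v y)
    ¬collinear = allowed ∘ from (T-∨ {collinear (end P) v y}) ∘ inj₁

    ¬near-later : ¬ T (collinearWithSome v (onPrefix (edge P ∘ suc) k) y)
    ¬near-later = allowed ∘ from (T-∨ {collinear (end P) v y}) ∘ inj₂
                ∘ from (T-∨ {collinearWithSome v (onPrefix (edge P ∘ suc) k) y}) ∘ inj₁

    ¬near-earlier : ¬ T (collinearWithSome (end P) (onPrefix (edge P) k) y)
    ¬near-earlier = allowed ∘ from (T-∨ {collinear (end P) v y}) ∘ inj₂
                  ∘ from (T-∨ {collinearWithSome v (onPrefix (edge P ∘ suc) k) y}) ∘ inj₂

    f∌v : ¬ T (mem f v)
    f∌v fv = ¬collinear (collinear-intro f fx fv fy)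

    f-disjoint-earlier : ∀ i → i < k → Disjoint f (edge P i)
    f-disjoint-earlier i i<k z fz ez =
      ¬near-earlier (collinearWithSome-intro f (onPrefix-intro (edge P) i<k ez) fx fz fy)

    h-disjoint-later : ∀ i → 1 ≤ i → i ≤ k → Disjoint h (edge P i)
    h-disjoint-later (suc i) _ i<k z hz ez =
      ¬near-later (collinearWithSome-intro h (onPrefix-intro (edge P ∘ suc) i<k ez) hv hz hy)

    edge′ : ℕ → Fin m
    edge′ = edge P [ suc k ]≔ f

    edge′-old : ∀ {i} → i ≤ k → edge′ i ≡ edge P i
    edge′-old i≤k = []≔-≢ (edge P) f (<⇒≢ (s≤s i≤k))

    edge′-new : edge′ (suc k) ≡ f
    edge′-new = []≔-≡ (edge P) (suc k) f

    consecutive′ : ∀ i → i < suc k → Meet (edge′ i) (edge′ (suc i))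
    consecutive′ i (s≤s i≤k) with m≤n⇒m<n∨m≡n i≤k
    ... | inj₁ i<k  = subst₂ Meet (sym (edge′-old (<⇒≤ i<k))) (sym (edge′-old i<k)) (consecutive P i i<k)
    ... | inj₂ refl = subst₂ Meet (sym (edge′-old ≤-refl)) (sym edge′-new)
                        (last-edge-≢ P f∌v f-disjoint-earlier , end P , edge-k∋end P , fx)

    far-disjoint′ : ∀ i j → suc i < j → j ≤ suc k → Disjoint (edge′ i) (edge′ j)
    far-disjoint′ i j i+1<j j≤k+1 with m≤n⇒m<n∨m≡n j≤k+1
    ... | inj₁ (s≤s j≤k) = subst₂ Disjoint (sym (edge′-old (≤-trans (n≤1+n i) (≤-trans (<⇒≤ i+1<j) j≤k))))
                             (sym (edge′-old j≤k)) (far-disjoint P i j i+1<j j≤k)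
    ... | inj₂ refl = subst₂ Disjoint (sym (edge′-old (<⇒≤ (s≤s⁻¹ i+1<j)))) (sym edge′-new)
                        (Disjoint-sym (f-disjoint-earlier i (s≤s⁻¹ i+1<j)))

    v∉edge′ : ∀ i → 1 ≤ i → i ≤ suc k → ¬ T (mem (edge′ i) v)
    v∉edge′ i 1≤i i≤k+1 with m≤n⇒m<n∨m≡n i≤k+1
    ... | inj₁ (s≤s i≤k) = v∉edge P i 1≤i i≤k ∘ mem-subst (edge′-old i≤k)
    ... | inj₂ refl      = f∌v ∘ mem-subst edge′-new

    next : Path (suc k)
    next = record
      { edge            = edge′
      ; end             = y
      ; edge-0∋v        = mem-subst (sym (edge′-old z≤n)) (edge-0∋v P)
      ; edge-k∋end      = mem-subst (sym edge′-new) fy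
      ; consecutive     = consecutive′
      ; far-disjoint    = far-disjoint′
      ; v∉edge          = v∉edge′
      ; end∈u           = uy
      ; end∉edge-0      = λ _ → first-edge-∌ P fx fy x≢y f∌v f-disjoint-earlier ∘ mem-subst (edge′-old z≤n)
      ; closer          = h
      ; closer∋v        = hv
      ; closer∋end      = hy
      ; closer-disjoint = λ i 1≤i i<k+1 z hz e′z →
          h-disjoint-later i 1≤i (s≤s⁻¹ i<k+1) z hz (mem-subst (edge′-old (s≤s⁻¹ i<k+1)) e′z)
      }

  extend : ∀ {ℓ} (P : Path k) → k ≤ ℓ → greedyBound r ℓ < degreeIn u (end P) → Path (suc k)
  extend P k≤ℓ dense
    with countFin-<⇒∃ (λ y → u y ∧ shadowAdj H (end P) y) (forbidden P) (≤-<-trans (countFin-forbidden-≤ P k≤ℓ) dense)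
  ... | y , uy∧xy , allowed with to (T-∧ {u y}) uy∧xy
  ...   | uy , xy with shadowAdj-elim xy | nbhd-elim (u⊆N y uy)
  ...     | x≢y , f , fx , fy | _ , h , hy , hv = Extension.next P uy x≢y fx fy hy hv allowed

  close : Path (suc k) → ContainsLinearCycle H (suc (suc (suc k)))
  close {k} P = linearCycle (suc (suc k)) cycle consecutive′ wrap far-disjoint′
    where
    cycle : ℕ → Fin m
    cycle = edge P [ suc (suc k) ]≔ closer P

    cycle-old : ∀ {i} → i ≤ suc k → cycle i ≡ edge P i
    cycle-old i≤k+1 = []≔-≢ (edge P) (closer P) (<⇒≢ (s≤s i≤k+1))

    cycle-new : cycle (suc (suc k)) ≡ closer P
    cycle-new = []≔-≡ (edge P) (suc (suc k)) (closer P)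

    consecutive′ : ∀ i → i < suc (suc k) → Meet (cycle i) (cycle (suc i))
    consecutive′ i (s≤s i≤k+1) with m≤n⇒m<n∨m≡n i≤k+1
    ... | inj₁ i<k+1 = subst₂ Meet (sym (cycle-old i≤k+1)) (sym (cycle-old i<k+1)) (consecutive P i i<k+1)
    ... | inj₂ refl  = subst₂ Meet (sym (cycle-old ≤-refl)) (sym cycle-new)
      ( (λ eq → v∉edge P (suc k) (s≤s z≤n) ≤-refl (mem-subst (sym eq) (closer∋v P)))
      , end P , edge-k∋end P , closer∋end P)

    wrap : Meet (cycle 0) (cycle (suc (suc k)))
    wrap = subst₂ Meet (sym (cycle-old z≤n)) (sym cycle-new)
      ( (λ eq → end∉edge-0 P (s≤s z≤n) (mem-subst (sym eq) (closer∋end P)))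
      , v , edge-0∋v P , closer∋v P)

    far-disjoint′ : ∀ i j → suc i < j → j ≤ suc (suc k) → ¬ (i ≡ 0 × j ≡ suc (suc k)) →
      Disjoint (cycle i) (cycle j)
    far-disjoint′ i j i+1<j j≤k+2 not-wrap with m≤n⇒m<n∨m≡n j≤k+2
    ... | inj₁ (s≤s j≤k+1) = subst₂ Disjoint (sym (cycle-old (≤-trans (n≤1+n i) (≤-trans (<⇒≤ i+1<j) j≤k+1))))
                               (sym (cycle-old j≤k+1)) (far-disjoint P i j i+1<j j≤k+1)
    far-disjoint′ zero    j _ _ not-wrap | inj₂ refl = ⊥-elim (not-wrap (refl , refl))
    far-disjoint′ (suc i) j i+1<j _ _    | inj₂ refl = subst₂ Disjoint (sym (cycle-old (<⇒≤ (s≤s⁻¹ i+1<j)))) (sym cycle-new)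
      (Disjoint-sym (closer-disjoint P (suc i) (s≤s z≤n) (s≤s⁻¹ i+1<j)))

  greedy-path : ∀ {ℓ x} → (∀ y → T (u y) → greedyBound r ℓ < degreeIn u y) → T (u x) → ∀ k → k ≤ ℓ → Path k
  greedy-path dense ux zero    _   = start ux
  greedy-path dense ux (suc k) k<ℓ = extend P (<⇒≤ k<ℓ) (dense (end P) (end∈u P))
    where
    P : Path k
    P = greedy-path dense ux k (<⇒≤ k<ℓ)

  dense⇒linearCycle : ∀ ℓ → 3 ≤ ℓ → (∀ y → T (u y) → greedyBound r ℓ < degreeIn u y) →
    ∀ {x} → T (u x) → ContainsLinearCycle H ℓ
  dense⇒linearCycle (suc (suc (suc k))) (s≤s (s≤s (s≤s _))) dense ux =
    close (greedy-path dense ux (suc k) (m≤n+m (suc k) 2))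

  linearCycle-free⇒low-degree : ∀ ℓ → 3 ≤ ℓ → ¬ ContainsLinearCycle H ℓ →
    ∀ {x} → T (u x) → ∃ λ y → T (u y) × degreeIn u y ≤ greedyBound r ℓ
  linearCycle-free⇒low-degree ℓ 3≤ℓ no-cycle ux
    with any? (λ y → T? (u y) ×-dec (degreeIn u y ≤? greedyBound r ℓ))
  ... | yes low = low
  ... | no ¬low = ⊥-elim (no-cycle (dense⇒linearCycle ℓ 3≤ℓ dense ux))
    where
    dense : ∀ y → T (u y) → greedyBound r ℓ < degreeIn u y
    dense y uy = ≰⇒> λ deg≤K → ¬low (y , uy , deg≤K)

lemma7p8 : (r ℓ n m : ℕ) → 2 ≤ r → 3 ≤ ℓ → (H : Hypergraph n m) →
    IsLinear H → EdgeSizesBetween2And r H → ¬ ContainsLinearCycle H ℓ →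
    (v : Fin n) →
    inducedEdgeCount (shadowAdj H) (nbhd H v) ≤ r ^ (r + 4) * ℓ * ∣ nbhd H v ∣
lemma7p8 r ℓ n m 2≤r 3≤ℓ H linear sizes no-cycle v = begin
  edgesIn N                      ≤⟨ edgesIn-≤-degenerate (greedyBound r ℓ) N low-degree ⟩
  (greedyBound r ℓ + greedyBound r ℓ) * countFin N
                                 ≤⟨ *-monoˡ-≤ (countFin N) (greedyBound-double-≤ r ℓ 2≤r (≤-trans (s≤s z≤n) 3≤ℓ)) ⟩
  r ^ (r + 4) * ℓ * countFin N   ≡⟨ cong (r ^ (r + 4) * ℓ *_) (card≡countFin (nbhd H v)) ⟨
  r ^ (r + 4) * ℓ * ∣ nbhd H v ∣ ∎
  where
  open ≤-Reasoning
  open Degeneracy (shadowAdj H) (shadowAdj-sym H)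
  N : Fin n → Bool
  N = lookup (nbhd H v)
  low-degree : ∀ u → u ⊆ᵇ N → ∀ x → T (u x) → ∃ λ y → T (u y) × degreeIn u y ≤ greedyBound r ℓ
  low-degree u u⊆N x = GreedyPath.linearCycle-free⇒low-degree H linear r (proj₂ ∘ sizes) v u u⊆N ℓ 3≤ℓ no-cycle
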